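{- Let $G=(V,E)$ be a finite graph and $v\in V$. Then $$\gamma_{coe}(G)-\deg(v)-1\leq \gamma_{coe}(G/v)\leq \gamma_{coe}(G)+\deg(v)-1,$$ where $\deg(v)$ is the degree of $v$ in $G$.
   Context: All graphs are finite, without loops and without directed edges. For a graph $H=(V,E)$, a set $D\subseteq V$ is a dominating set if every vertex in $V\setminus D$ is adjacent to at least one vertex of $D$. A dominating set $D$ is a co-even dominating set if every vertex $u\in V\setminus D$ has even degree in $H$. The co-even domination number $\gamma_{coe}(H)$ is the minimum cardinality of a co-even dominating set of $H$. The vertex contraction $G/v$ is the graph obtained from $G$ by deleting $v$ (and its incident edges) and making the open neighbourhood $N_G(v)=\{u: uv\in E\}$ a clique; no parallel edges are created (two neighbours of $v$ that were already adjacent remain simply adjacent). -}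

module Defs where

open import Data.Nat using (ℕ; _+_; _≤_)
open import Data.Bool using (Bool; true; false; if_then_else_; _∨_; _∧_)
open import Data.Fin using (Fin; punchIn)
open import Data.Fin.Subset using (Subset; _∈_; _∉_; ∣_∣)
open import Data.List using (List; length; filter)
open import Data.Fin.Base using () 
open import Data.List.Base using ()
open import Data.Vec.Functional using ()
open import Data.Product using (Σ; ∃; _×_; _,_)
open import Relation.Binary.PropositionalEquality using (_≡_; refl; cong₂; sym)
open import Relation.Nullary using (yes; no)
open import Data.Bool.Properties using (∨-comm; ∧-comm)
open import Relation.Nullary using (¬_)
open import Data.Bool.Properties using (T?)
open import Data.Bool using (T)
import Data.List as L
import Data.Empty
open import Data.Fin.Properties using (_≟_)
open import Relation.Nullary.Decidable using (⌊_⌋)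

record Graph (n : ℕ) : Set where
  field
    adj    : Fin n → Fin n → Bool
    adj-sym    : ∀ u w → adj u w ≡ adj w u
    adj-irrefl : ∀ u → adj u u ≡ false
open Graph public

vertices : (n : ℕ) → List (Fin n)
vertices n = L.allFin n

deg : ∀ {n} → Graph n → Fin n → ℕ
deg {n} G u = length (filter (λ w → T? (adj G u w)) (vertices n))

Even : ℕ → Set
Even m = ∃ λ k → m ≡ k + k

IsDominating : ∀ {n} → Graph n → Subset n → Set
IsDominating {n} G D = ∀ u → u ∉ D → ∃ λ w → w ∈ D × adj G u w ≡ true

IsCoEvenDominating : ∀ {n} → Graph n → Subset n → Set
IsCoEvenDominating {n} G D = IsDominating G D × (∀ u → u ∉ D → Even (deg G u))

IsCoEvenDomNumber : ∀ {n} → Graph n → ℕ → Set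
IsCoEvenDomNumber {n} G k =
  (∃ λ D → IsCoEvenDominating G D × ∣ D ∣ ≡ k) ×
  (∀ D → IsCoEvenDominating G D → k ≤ ∣ D ∣)

-- vertex contraction G/v on vertex set Fin n (vertices of G other than v,
-- indexed via punchIn v): delete v and make N(v) a clique.
contractAdj : ∀ {n} → Graph (Data.Nat.suc n) → Fin (Data.Nat.suc n) → Fin n → Fin n → Bool
contractAdj G v i j =
  if ⌊ i ≟ j ⌋ then false
  else (adj G (punchIn v i) (punchIn v j) ∨ (adj G v (punchIn v i) ∧ adj G v (punchIn v j)))

contractAdj-sym : ∀ {n} (G : Graph (Data.Nat.suc n)) v i j → contractAdj G v i j ≡ contractAdj G v j i
contractAdj-sym G v i j with i ≟ j | j ≟ i
... | yes _ | yes _ = refl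
... | yes p | no q = Data.Empty.⊥-elim (q (sym p))
... | no p | yes q = Data.Empty.⊥-elim (p (sym q))
... | no _ | no _ =
  cong₂ _∨_ (Graph.adj-sym G (punchIn v i) (punchIn v j))
            (∧-comm (adj G v (punchIn v i)) (adj G v (punchIn v j)))

contractAdj-irrefl : ∀ {n} (G : Graph (Data.Nat.suc n)) v i → contractAdj G v i i ≡ false
contractAdj-irrefl G v i with i ≟ i
... | yes _ = refl
... | no p = Data.Empty.⊥-elim (p refl)

_/_ : ∀ {n} → Graph (Data.Nat.suc n) → Fin (Data.Nat.suc n) → Graph n
G / v = record
  { adj = contractAdj G v
  ; adj-sym = contractAdj-sym G v
  ; adj-irrefl = contractAdj-irrefl G v
  }

-- Co-even dominating sets transfer between G and G / v at the cost of N[v].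
-- Away from N(v) the contraction changes neither adjacency nor degrees, so a
-- co-even dominating set D′ of G / v, together with N[v], is one of G
-- (size ≤ ∣D′∣ + deg v + 1); conversely for a co-even dominating set D of G,
-- (D ∖ {v}) ∪ N(v) is one of G / v, of size ≤ ∣D∣ + deg v − 1: either v ∈ D is
-- dropped, or v has a neighbour in D which is counted twice.
module Submission where

open import Defs
open import Data.Nat using (ℕ; suc; _+_; _≤_; z≤n; s≤s)
open import Data.Nat.Properties using (≤-trans; m≤m+n; +-comm; +-monoˡ-≤; +-monoʳ-≤; +-suc; module ≤-Reasoning)
open import Data.Bool using (Bool; true; false)
open import Data.Bool.Properties using (T?; ∨-identityʳ)
open import Data.Fin using (Fin; zero; suc; punchIn; punchOut)
open import Data.Fin.Properties using (_≟_; punchIn-punchOut)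
open import Data.Fin.Subset using (Subset; inside; outside; _∈_; _∉_; _∪_; _∩_; ∣_∣)
open import Data.Fin.Subset.Properties using (x∈p∪q⁺; x∈p∩q⁺; x∈p⇒∣p-x∣<∣p∣; ∣p∣≤∣x∷p∣)
open import Data.Vec using (Vec; []; _∷_; lookup; tabulate; insertAt; removeAt)
open import Data.Vec.Properties using ([]=⇒lookup; lookup⇒[]=; lookup∘tabulate; tabulate∘lookup; tabulate-cong; insertAt-lookup; insertAt-punchIn; insertAt-removeAt)
import Data.List as List
open import Data.Product using (∃; _×_; _,_; proj₁)
open import Data.Sum using (_⊎_; inj₁; inj₂)
open import Function using (id; _∘_; case_of_)
open import Relation.Binary.PropositionalEquality
open import Relation.Nullary using (yes; no; contradiction)

lookup-removeAt-punchIn : ∀ {A : Set} {n} (xs : Vec A (suc n)) i j →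
  lookup (removeAt xs i) j ≡ lookup xs (punchIn i j)
lookup-removeAt-punchIn (x ∷ xs) zero j = refl
lookup-removeAt-punchIn (x ∷ y ∷ xs) (suc i) zero = refl
lookup-removeAt-punchIn (x ∷ y ∷ xs) (suc i) (suc j) = lookup-removeAt-punchIn (y ∷ xs) i j

∉⇒lookup≡outside : ∀ {n} {x : Fin n} (p : Subset n) → x ∉ p → lookup p x ≡ outside
∉⇒lookup≡outside {x = x} p x∉p with lookup p x in eq
... | inside  = contradiction (lookup⇒[]= x p eq) x∉p
... | outside = refl

∣x∷y∷p∣≡∣y∷x∷p∣ : ∀ {n} x y (p : Subset n) → ∣ x ∷ y ∷ p ∣ ≡ ∣ y ∷ x ∷ p ∣
∣x∷y∷p∣≡∣y∷x∷p∣ inside  inside  p = refl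
∣x∷y∷p∣≡∣y∷x∷p∣ inside  outside p = refl
∣x∷y∷p∣≡∣y∷x∷p∣ outside inside  p = refl
∣x∷y∷p∣≡∣y∷x∷p∣ outside outside p = refl

∣insertAt∣ : ∀ {n} (p : Subset n) i x → ∣ insertAt p i x ∣ ≡ ∣ x ∷ p ∣
∣insertAt∣ p zero x = refl
∣insertAt∣ (inside ∷ p) (suc i) x = trans (cong suc (∣insertAt∣ p i x)) (∣x∷y∷p∣≡∣y∷x∷p∣ inside x p)
∣insertAt∣ (outside ∷ p) (suc i) x = trans (∣insertAt∣ p i x) (∣x∷y∷p∣≡∣y∷x∷p∣ outside x p)

∣p∣≡∣p[i]∷removeAt∣ : ∀ {n} (p : Subset (suc n)) i → ∣ p ∣ ≡ ∣ lookup p i ∷ removeAt p i ∣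
∣p∣≡∣p[i]∷removeAt∣ p i = trans (cong ∣_∣ (sym (insertAt-removeAt p i))) (∣insertAt∣ (removeAt p i) i (lookup p i))

∣removeAt∣≤∣p∣ : ∀ {n} (p : Subset (suc n)) i → ∣ removeAt p i ∣ ≤ ∣ p ∣
∣removeAt∣≤∣p∣ p i = subst (∣ removeAt p i ∣ ≤_) (sym (∣p∣≡∣p[i]∷removeAt∣ p i)) (∣p∣≤∣x∷p∣ (lookup p i) (removeAt p i))

∈⇒∣p∣≡suc∣removeAt∣ : ∀ {n} {i : Fin (suc n)} (p : Subset (suc n)) → i ∈ p → ∣ p ∣ ≡ suc ∣ removeAt p i ∣
∈⇒∣p∣≡suc∣removeAt∣ {i = i} p i∈p = trans (∣p∣≡∣p[i]∷removeAt∣ p i) (cong (λ x → ∣ x ∷ removeAt p i ∣) ([]=⇒lookup i∈p))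

∣p∪q∣+∣p∩q∣≡∣p∣+∣q∣ : ∀ {n} (p q : Subset n) → ∣ p ∪ q ∣ + ∣ p ∩ q ∣ ≡ ∣ p ∣ + ∣ q ∣
∣p∪q∣+∣p∩q∣≡∣p∣+∣q∣ [] [] = refl
∣p∪q∣+∣p∩q∣≡∣p∣+∣q∣ (inside ∷ p) (inside ∷ q) =
  cong suc (trans (+-suc _ _) (trans (cong suc (∣p∪q∣+∣p∩q∣≡∣p∣+∣q∣ p q)) (sym (+-suc _ _))))
∣p∪q∣+∣p∩q∣≡∣p∣+∣q∣ (inside ∷ p) (outside ∷ q) = cong suc (∣p∪q∣+∣p∩q∣≡∣p∣+∣q∣ p q)
∣p∪q∣+∣p∩q∣≡∣p∣+∣q∣ (outside ∷ p) (inside ∷ q) = trans (cong suc (∣p∪q∣+∣p∩q∣≡∣p∣+∣q∣ p q)) (sym (+-suc _ _))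
∣p∪q∣+∣p∩q∣≡∣p∣+∣q∣ (outside ∷ p) (outside ∷ q) = ∣p∪q∣+∣p∩q∣≡∣p∣+∣q∣ p q

∣p∪q∣≤∣p∣+∣q∣ : ∀ {n} (p q : Subset n) → ∣ p ∪ q ∣ ≤ ∣ p ∣ + ∣ q ∣
∣p∪q∣≤∣p∣+∣q∣ p q = subst (∣ p ∪ q ∣ ≤_) (∣p∪q∣+∣p∩q∣≡∣p∣+∣q∣ p q) (m≤m+n _ _)

∉p∪q⇒∉p×∉q : ∀ {n} {x : Fin n} {p q : Subset n} → x ∉ p ∪ q → x ∉ p × x ∉ q
∉p∪q⇒∉p×∉q x∉p∪q = x∉p∪q ∘ x∈p∪q⁺ ∘ inj₁ , x∉p∪q ∘ x∈p∪q⁺ ∘ inj₂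

punchIn∈insertAt : ∀ {n} {j : Fin n} {p : Subset n} i x → j ∈ p → punchIn i j ∈ insertAt p i x
punchIn∈insertAt {j = j} {p} i x j∈p =
  lookup⇒[]= (punchIn i j) _ (trans (insertAt-punchIn p i x j) ([]=⇒lookup j∈p))

∉insertAt-inside : ∀ {n} {u : Fin (suc n)} {p : Subset n} i →
  u ∉ insertAt p i inside → ∃ λ j → punchIn i j ≡ u × j ∉ p
∉insertAt-inside {u = u} {p} i u∉ with i ≟ u
... | yes refl = contradiction (lookup⇒[]= i _ (insertAt-lookup p i inside)) u∉
... | no i≢u   = punchOut i≢u , punchIn-punchOut i≢u ,
                 λ j∈p → u∉ (subst (_∈ _) (punchIn-punchOut i≢u) (punchIn∈insertAt i inside j∈p))

punchIn∈⇒∈removeAt : ∀ {n} {j : Fin n} {p : Subset (suc n)} i → punchIn i j ∈ p → j ∈ removeAt p i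
punchIn∈⇒∈removeAt {j = j} {p} i ij∈p =
  lookup⇒[]= j _ (trans (lookup-removeAt-punchIn p i j) ([]=⇒lookup ij∈p))

removeAt-tabulate : ∀ {A : Set} {n} (f : Fin (suc n) → A) i →
  removeAt (tabulate f) i ≡ tabulate (f ∘ punchIn i)
removeAt-tabulate f i = trans (sym (tabulate∘lookup _))
  (tabulate-cong λ j → trans (lookup-removeAt-punchIn (tabulate f) i j) (lookup∘tabulate f (punchIn i j)))

length-filter≡∣tabulate∣ : ∀ {A : Set} {n} (f : A → Bool) (g : Fin n → A) →
  List.length (List.filter (T? ∘ f) (List.tabulate g)) ≡ ∣ tabulate (f ∘ g) ∣
length-filter≡∣tabulate∣ {n = 0} f g = refl
length-filter≡∣tabulate∣ {n = suc n} f g with f (g zero)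
... | true  = cong suc (length-filter≡∣tabulate∣ f (g ∘ suc))
... | false = length-filter≡∣tabulate∣ f (g ∘ suc)

neighbours : ∀ {n} → Graph n → Fin n → Subset n
neighbours G u = tabulate (adj G u)

deg≡∣neighbours∣ : ∀ {n} (G : Graph n) u → deg G u ≡ ∣ neighbours G u ∣
deg≡∣neighbours∣ G u = length-filter≡∣tabulate∣ (adj G u) id

deg-nonadjacent : ∀ {n} (G : Graph (suc n)) {u v} → adj G u v ≡ false →
  deg G u ≡ ∣ tabulate (adj G u ∘ punchIn v) ∣
deg-nonadjacent G {u} {v} uv≡false = begin
  deg G u                                                          ≡⟨ deg≡∣neighbours∣ G u ⟩
  ∣ neighbours G u ∣                                               ≡⟨ ∣p∣≡∣p[i]∷removeAt∣ (neighbours G u) v ⟩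
  ∣ lookup (neighbours G u) v ∷ removeAt (neighbours G u) v ∣      ≡⟨ cong₂ (λ x p → ∣ x ∷ p ∣)
                                                                         (trans (lookup∘tabulate (adj G u) v) uv≡false)
                                                                         (removeAt-tabulate (adj G u) v) ⟩
  ∣ outside ∷ tabulate (adj G u ∘ punchIn v) ∣                     ∎
  where open ≡-Reasoning

link : ∀ {n} → Graph (suc n) → Fin (suc n) → Subset n
link G v = tabulate (adj G v ∘ punchIn v)

∣link∣≡deg : ∀ {n} (G : Graph (suc n)) v → ∣ link G v ∣ ≡ deg G v
∣link∣≡deg G v = sym (deg-nonadjacent G (adj-irrefl G v))

∉link⇒nonadjacent : ∀ {n} (G : Graph (suc n)) {v i} → i ∉ link G v → adj G v (punchIn v i) ≡ false
∉link⇒nonadjacent G {v} {i} i∉link =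
  trans (sym (lookup∘tabulate (adj G v ∘ punchIn v) i)) (∉⇒lookup≡outside (link G v) i∉link)

adjacent⇒∈link : ∀ {n} (G : Graph (suc n)) {v i} → adj G v (punchIn v i) ≡ true → i ∈ link G v
adjacent⇒∈link G {v} {i} vi≡true = lookup⇒[]= i _ (trans (lookup∘tabulate (adj G v ∘ punchIn v) i) vi≡true)

adj-/-nonadjacent : ∀ {n} (G : Graph (suc n)) {v i} j → adj G v (punchIn v i) ≡ false →
  adj (G / v) i j ≡ adj G (punchIn v i) (punchIn v j)
adj-/-nonadjacent G {v} {i} j vi≡false with i ≟ j
... | yes refl = sym (adj-irrefl G (punchIn v i))
... | no _ rewrite vi≡false = ∨-identityʳ _

deg-/-nonadjacent : ∀ {n} (G : Graph (suc n)) {v i} → adj G v (punchIn v i) ≡ false →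
  deg (G / v) i ≡ deg G (punchIn v i)
deg-/-nonadjacent G {v} {i} vi≡false = begin
  deg (G / v) i                                 ≡⟨ deg≡∣neighbours∣ (G / v) i ⟩
  ∣ neighbours (G / v) i ∣                      ≡⟨ cong ∣_∣ (tabulate-cong λ j → adj-/-nonadjacent G j vi≡false) ⟩
  ∣ tabulate (adj G (punchIn v i) ∘ punchIn v) ∣ ≡⟨ deg-nonadjacent G (trans (adj-sym G _ v) vi≡false) ⟨
  deg G (punchIn v i)                           ∎
  where open ≡-Reasoning

adjacent-nonadjacent⇒≢ : ∀ {n} (G : Graph n) {u w w′} → adj G u w ≡ true → adj G u w′ ≡ false → w ≢ w′
adjacent-nonadjacent⇒≢ G uw≡true uw′≡false refl with trans (sym uw≡true) uw′≡false
... | ()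

≢⇒punchIn-image : ∀ {n} {v w : Fin (suc n)} → w ≢ v → ∃ λ j → punchIn v j ≡ w
≢⇒punchIn-image w≢v = punchOut (w≢v ∘ sym) , punchIn-punchOut (w≢v ∘ sym)

coEvenDominating-from-/ : ∀ {n} (G : Graph (suc n)) v {D} → IsCoEvenDominating (G / v) D →
  IsCoEvenDominating G (insertAt (link G v ∪ D) v inside)
coEvenDominating-from-/ G v {D} (dom , even) = dom↑ , even↑
  where
  outside-lift : ∀ {u} → u ∉ insertAt (link G v ∪ D) v inside →
    ∃ λ i → punchIn v i ≡ u × adj G v (punchIn v i) ≡ false × i ∉ D
  outside-lift u∉ with ∉insertAt-inside v u∉
  ... | i , vi≡u , i∉ = let i∉link , i∉D = ∉p∪q⇒∉p×∉q i∉ in i , vi≡u , ∉link⇒nonadjacent G i∉link , i∉D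

  dom↑ : IsDominating G (insertAt (link G v ∪ D) v inside)
  dom↑ u u∉ with outside-lift u∉
  ... | i , refl , vi≡false , i∉D with dom i i∉D
  ...   | j , j∈D , ij≡true =
    punchIn v j , punchIn∈insertAt v inside (x∈p∪q⁺ (inj₂ j∈D)) ,
    trans (sym (adj-/-nonadjacent G j vi≡false)) ij≡true

  even↑ : ∀ u → u ∉ insertAt (link G v ∪ D) v inside → Even (deg G u)
  even↑ u u∉ with outside-lift u∉
  ... | i , refl , vi≡false , i∉D = subst Even (deg-/-nonadjacent G vi≡false) (even i i∉D)

∣insertAt[link∪D]∣≤∣D∣+deg+1 : ∀ {n} (G : Graph (suc n)) v D →
  ∣ insertAt (link G v ∪ D) v inside ∣ ≤ ∣ D ∣ + deg G v + 1
∣insertAt[link∪D]∣≤∣D∣+deg+1 G v D = begin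
  ∣ insertAt (link G v ∪ D) v inside ∣ ≡⟨ ∣insertAt∣ (link G v ∪ D) v inside ⟩
  suc ∣ link G v ∪ D ∣                 ≤⟨ s≤s (∣p∪q∣≤∣p∣+∣q∣ (link G v) D) ⟩
  suc (∣ link G v ∣ + ∣ D ∣)           ≡⟨ cong (λ k → suc (k + ∣ D ∣)) (∣link∣≡deg G v) ⟩
  suc (deg G v + ∣ D ∣)                ≡⟨ cong suc (+-comm (deg G v) ∣ D ∣) ⟩
  suc (∣ D ∣ + deg G v)                ≡⟨ +-comm 1 (∣ D ∣ + deg G v) ⟩
  ∣ D ∣ + deg G v + 1                  ∎
  where open ≤-Reasoning

coEvenDominating-/ : ∀ {n} (G : Graph (suc n)) v {D} → IsCoEvenDominating G D →
  IsCoEvenDominating (G / v) (removeAt D v ∪ link G v)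
coEvenDominating-/ G v {D} (dom , even) = dom↓ , even↓
  where
  outside-restrict : ∀ {i} → i ∉ removeAt D v ∪ link G v →
    punchIn v i ∉ D × adj G v (punchIn v i) ≡ false
  outside-restrict i∉ = let i∉R , i∉link = ∉p∪q⇒∉p×∉q i∉ in
    i∉R ∘ punchIn∈⇒∈removeAt v , ∉link⇒nonadjacent G i∉link

  dom↓ : IsDominating (G / v) (removeAt D v ∪ link G v)
  dom↓ i i∉ with outside-restrict i∉
  ... | vi∉D , vi≡false with dom (punchIn v i) vi∉D
  ...   | w , w∈D , iw≡true
        with ≢⇒punchIn-image (adjacent-nonadjacent⇒≢ G iw≡true (trans (adj-sym G _ v) vi≡false))
  ...     | j , refl =
    j , x∈p∪q⁺ (inj₁ (punchIn∈⇒∈removeAt v w∈D)) , trans (adj-/-nonadjacent G j vi≡false) iw≡true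

  even↓ : ∀ i → i ∉ removeAt D v ∪ link G v → Even (deg (G / v) i)
  even↓ i i∉ with outside-restrict i∉
  ... | vi∉D , vi≡false = subst Even (sym (deg-/-nonadjacent G vi≡false)) (even _ vi∉D)

-- If v ∉ D, a neighbour of v in D is counted both in removeAt D v and in link G v.
∈-or-overlap : ∀ {n} (G : Graph (suc n)) v {D} → IsDominating G D →
  (v ∈ D) ⊎ (1 ≤ ∣ removeAt D v ∩ link G v ∣)
∈-or-overlap G v {D} dom with lookup D v in eq
... | inside  = inj₁ (lookup⇒[]= v D eq)
... | outside with dom v (λ v∈D → case trans (sym ([]=⇒lookup v∈D)) eq of λ ())
...   | w , w∈D , vw≡true with ≢⇒punchIn-image (adjacent-nonadjacent⇒≢ G vw≡true (adj-irrefl G v))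
...     | j , refl = inj₂ (≤-trans (s≤s z≤n) (x∈p⇒∣p-x∣<∣p∣ j∈R∩link))
  where
  j∈R∩link : j ∈ removeAt D v ∩ link G v
  j∈R∩link = x∈p∩q⁺ (punchIn∈⇒∈removeAt v w∈D , adjacent⇒∈link G vw≡true)

∣removeAt[D]∪link∣<∣D∣+deg : ∀ {n} (G : Graph (suc n)) v {D} → IsDominating G D →
  ∣ removeAt D v ∪ link G v ∣ + 1 ≤ ∣ D ∣ + deg G v
∣removeAt[D]∪link∣<∣D∣+deg {n} G v {D} dom = bound (∈-or-overlap G v dom)
  where
  open ≤-Reasoning
  R L : Subset n
  R = removeAt D v
  L = link G v

  bound : (v ∈ D) ⊎ (1 ≤ ∣ R ∩ L ∣) → ∣ R ∪ L ∣ + 1 ≤ ∣ D ∣ + deg G v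
  bound (inj₁ v∈D) = begin
    ∣ R ∪ L ∣ + 1         ≤⟨ +-monoˡ-≤ 1 (∣p∪q∣≤∣p∣+∣q∣ R L) ⟩
    ∣ R ∣ + ∣ L ∣ + 1     ≡⟨ +-comm (∣ R ∣ + ∣ L ∣) 1 ⟩
    suc ∣ R ∣ + ∣ L ∣     ≡⟨ cong₂ _+_ (sym (∈⇒∣p∣≡suc∣removeAt∣ D v∈D)) (∣link∣≡deg G v) ⟩
    ∣ D ∣ + deg G v       ∎
  bound (inj₂ 1≤∣R∩L∣) = begin
    ∣ R ∪ L ∣ + 1         ≤⟨ +-monoʳ-≤ ∣ R ∪ L ∣ 1≤∣R∩L∣ ⟩
    ∣ R ∪ L ∣ + ∣ R ∩ L ∣ ≡⟨ ∣p∪q∣+∣p∩q∣≡∣p∣+∣q∣ R L ⟩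
    ∣ R ∣ + ∣ L ∣         ≤⟨ +-monoˡ-≤ ∣ L ∣ (∣removeAt∣≤∣p∣ D v) ⟩
    ∣ D ∣ + ∣ L ∣         ≡⟨ cong (∣ D ∣ +_) (∣link∣≡deg G v) ⟩
    ∣ D ∣ + deg G v       ∎

theorem3p1 : ∀ {n} (G : Graph (suc n)) (v : Fin (suc n)) (γG γGv : ℕ) →
    IsCoEvenDomNumber G γG → IsCoEvenDomNumber (G / v) γGv →
    (γG ≤ γGv + deg G v + 1) × (γGv + 1 ≤ γG + deg G v)
theorem3p1 G v _ _ ((D , D-coEven , refl) , γG-minimal) ((D′ , D′-coEven , refl) , γGv-minimal) =
    ≤-trans (γG-minimal _ (coEvenDominating-from-/ G v D′-coEven)) (∣insertAt[link∪D]∣≤∣D∣+deg+1 G v D′)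
  , ≤-trans (+-monoˡ-≤ 1 (γGv-minimal _ (coEvenDominating-/ G v D-coEven)))
            (∣removeAt[D]∪link∣<∣D∣+deg G v (proj₁ D-coEven))
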